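{- Let $d\ge 2$ be an integer and $\alpha=\frac{d+\sqrt{d^2+4}}{2}$. For every non-negative integer $n$, \[\mathtt{out}(n)=\left\lfloor \alpha n+\frac1\alpha\right\rfloor .\]
   Context: Define $(D_n)$ by $D_0=0$, $D_1=1$, $D_{n+1}=dD_n+D_{n-1}$ (so $D_2=d$, $D_3=d^2+1,\dots$). An Ostrowski word is a finite word $d_1d_2\cdots d_i$ over $\{0,1,\dots,d\}$ with $0\le d_1<d$, $0\le d_j\le d$ for $j>1$, and $d_{j-1}=0$ whenever $d_j=d$ ($j\ge 2$). It represents the integer $\sum_{j=1}^i d_jD_j$ (least significant digit first). Every non-negative integer $N$ has a unique representation by an Ostrowski word with nonzero last digit (the empty word for $N=0$). For a non-negative integer $n$ with Ostrowski word $d_1\cdots d_i$, $\mathtt{out}(n)$ is the integer represented by the word $0d_1\cdots d_i$, i.e. $\mathtt{out}(n)=\sum_{j=1}^i d_jD_{j+1}$. -}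

module Defs where

open import Data.Nat as ℕ using (ℕ; zero; suc; _≤_; _<_)
open import Data.Integer as ℤ using (ℤ; +_)
open import Data.List using (List; []; _∷_)
open import Data.Product using (_×_)
open import Data.Sum using (_⊎_)
open import Relation.Binary.PropositionalEquality using (_≡_; _≢_)

Dseq : ℕ → ℕ → ℕ
Dseq d zero = 0
Dseq d (suc zero) = 1
Dseq d (suc (suc n)) = d ℕ.* Dseq d (suc n) ℕ.+ Dseq d n

data OstTail (d : ℕ) : ℕ → List ℕ → Set where
  []  : ∀ {p} → OstTail d p []
  _∷_ : ∀ {p x xs} → (x ≤ d) × (x ≡ d → p ≡ 0) → OstTail d x xs → OstTail d p (x ∷ xs)

-- Ostrowski word d_1 d_2 ... d_i (least significant digit first):
-- 0 ≤ d_1 < d, 0 ≤ d_j ≤ d, and d_{j-1} = 0 whenever d_j = d (j ≥ 2).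
Ostrowski : ℕ → List ℕ → Set
Ostrowski d [] = Data.Unit.⊤ where import Data.Unit
Ostrowski d (x ∷ xs) = (x < d) × OstTail d x xs

LastNonzero : List ℕ → Set
LastNonzero [] = Data.Unit.⊤ where import Data.Unit
LastNonzero (x ∷ []) = x ≢ 0
LastNonzero (x ∷ y ∷ ys) = LastNonzero (y ∷ ys)

valFrom : ℕ → ℕ → List ℕ → ℕ
valFrom d k [] = 0
valFrom d k (x ∷ xs) = x ℕ.* Dseq d k ℕ.+ valFrom d (suc k) xs

val : ℕ → List ℕ → ℕ
val d w = valFrom d 1 w

-- Comparisons between an integer and c·√Δ (c, Δ natural), exactly.
-- L ≤ c√Δ  iff  L ≤ 0  or  L² ≤ Δ c²
IntLeSqrt : ℕ → ℕ → ℤ → Set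
IntLeSqrt Δ c L = (L ℤ.≤ + 0) ⊎ (L ℤ.* L ℤ.≤ + (Δ ℕ.* (c ℕ.* c)))

-- c√Δ < U  iff  U > 0  and  Δ c² < U²
SqrtLtInt : ℕ → ℕ → ℤ → Set
SqrtLtInt Δ c U = (+ 0 ℤ.< U) × (+ (Δ ℕ.* (c ℕ.* c)) ℤ.< U ℤ.* U)

-- With α = (d + √(d²+4))/2 one has 1/α = (√(d²+4) − d)/2, hence
--   α n + 1/α = (d(n−1) + (n+1)√(d²+4)) / 2.
-- IsFloorAlpha d n m  means  m = ⌊α n + 1/α⌋, i.e.
--   m ≤ α n + 1/α < m + 1, i.e.
--   2m − d(n−1) ≤ (n+1)√(d²+4) < 2m + 2 − d(n−1).
IsFloorAlpha : ℕ → ℕ → ℤ → Set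
IsFloorAlpha d n m =
  IntLeSqrt (d ℕ.* d ℕ.+ 4) (suc n) (lo ) ×
  SqrtLtInt (d ℕ.* d ℕ.+ 4) (suc n) (lo ℤ.+ + 2)
  where
  lo : ℤ
  lo = (+ 2) ℤ.* m ℤ.- (+ d) ℤ.* ((+ n) ℤ.- (+ 1))

{-# OPTIONS --safe #-}
module Submission where

-- The key quantity is e = Σ d_j D_{j-1}, the value of the word with every weight shifted down
-- one place: by the recurrence for D, out(n) = d n + e.  Since α = d + 1/α, the claim
-- ⌊α n + 1/α⌋ = d n + e amounts to e = ⌊(n + 1)/α⌋.  Prepending a digit x to a word turns the
-- pair (e, n) into (n, x + d n + e), and the bounds α e < n + 1 and n < α (e + 1) survive this
-- as long as x ≤ d; a first digit x < d sharpens the second bound to n + 1 < α (e + 1).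

open import Defs
open import Data.Nat using (ℕ; _≤_)
open import Data.Integer using (+_)
open import Data.List using (List; _∷_)
open import Relation.Binary.PropositionalEquality using (_≡_)

open import Data.Nat using (suc; _+_; _*_; _∸_; _<_; z≤n; s≤s)
open import Data.Nat.Properties
open import Data.Nat.Tactic.RingSolver using (solve-∀)
import Data.Integer as ℤ
import Data.Integer.Properties as ℤ
import Data.Integer.Tactic.RingSolver as ℤ-Solver
open import Data.List using ([])
open import Data.Product using (_×_; _,_)
open import Data.Sum using (inj₂)
open import Relation.Binary.PropositionalEquality
  using (refl; sym; trans; cong; cong₂; subst; subst₂; module ≡-Reasoning)

valFrom-suc-suc : ∀ d k w →
  valFrom d (suc (suc k)) w ≡ d * valFrom d (suc k) w + valFrom d k w
valFrom-suc-suc d k [] = sym (trans (+-identityʳ (d * 0)) (*-zeroʳ d))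
valFrom-suc-suc d k (x ∷ xs) = begin
    x * Dseq d (suc (suc k)) + valFrom d (suc (suc (suc k))) xs
  ≡⟨ cong (λ v → x * Dseq d (suc (suc k)) + v) (valFrom-suc-suc d (suc k) xs) ⟩
    x * (d * Dseq d (suc k) + Dseq d k)
      + (d * valFrom d (suc (suc k)) xs + valFrom d (suc k) xs)
  ≡⟨ regroup x d (Dseq d (suc k)) (Dseq d k) _ _ ⟩
    d * valFrom d (suc k) (x ∷ xs) + valFrom d k (x ∷ xs) ∎
  where
  open ≡-Reasoning
  regroup : ∀ x d a b p q →
    x * (d * a + b) + (d * p + q) ≡ d * (x * a + p) + (x * b + q)
  regroup = solve-∀

valFrom-zero-∷ : ∀ d x xs → valFrom d 0 (x ∷ xs) ≡ val d xs
valFrom-zero-∷ d x xs = cong (_+ val d xs) (*-zeroʳ x)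

val-∷ : ∀ d x xs → val d (x ∷ xs) ≡ x + d * val d xs + valFrom d 0 xs
val-∷ d x xs = trans (cong₂ _+_ (*-identityʳ x) (valFrom-suc-suc d 0 xs))
                     (sym (+-assoc x (d * val d xs) (valFrom d 0 xs)))

-- Since b² − d a b − a² = (b − α a)(b + a/α), for a, b ∈ ℕ not both 0 it has the sign of b − α a.
infix 4 α[_]*_<_ _<α[_]*_

α[_]*_<_ : ℕ → ℕ → ℕ → Set
α[ d ]* a < b = d * a * b + a * a < b * b

_<α[_]*_ : ℕ → ℕ → ℕ → Set
b <α[ d ]* a = b * b < d * a * b + a * a

-- For c = 1 this says e = ⌊(n + 1)/α⌋.
AlphaBracket : ℕ → ℕ → ℕ → ℕ → Set
AlphaBracket d c e n = α[ d ]* e < suc n × c + n <α[ d ]* suc e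

α*n<suc[x+dn+e] : ∀ d n e x → n <α[ d ]* suc e → α[ d ]* n < suc (x + d * n + e)
α*n<suc[x+dn+e] d n e x n<α[e+1] = begin-strict
    d * n * t + n * n
  <⟨ +-monoʳ-< (d * n * t) n<α[e+1] ⟩
    d * n * t + (d * suc e * n + suc e * suc e)
  ≤⟨ m≤m+n _ _ ⟩
    d * n * t + (d * suc e * n + suc e * suc e) + x * (x + d * n + 2 * suc e)
  ≡⟨ sym (expand d n e x) ⟩
    t * t ∎
  where
  open ≤-Reasoning
  t : ℕ
  t = suc (x + d * n + e)
  expand : ∀ d n e x →
    suc (x + d * n + e) * suc (x + d * n + e)
      ≡ d * n * suc (x + d * n + e) + (d * suc e * n + suc e * suc e)
        + x * (x + d * n + 2 * suc e)
  expand = solve-∀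

≤dm+e⇒<α*m : ∀ d m e {s} → s ≤ d * m + e → α[ d ]* e < m → s <α[ d ]* m
≤dm+e⇒<α*m d m e {s} s≤dm+e αe<m = begin-strict
    s * s
  ≤⟨ m≤m+n _ _ ⟩
    s * s + k * (s + e)
  ≡⟨ +-cancelʳ-≡ (e * s) _ _ excess ⟩
    d * m * s + (d * e * m + e * e)
  <⟨ +-monoʳ-< (d * m * s) αe<m ⟩
    d * m * s + m * m ∎
  where
  open ≤-Reasoning
  k : ℕ
  k = d * m + e ∸ s
  excess : s * s + k * (s + e) + e * s ≡ d * m * s + (d * e * m + e * e) + e * s
  excess = begin-equality
      s * s + k * (s + e) + e * s
    ≡⟨ factor s k e ⟩
      (s + k) * (s + e)
    ≡⟨ cong (_* (s + e)) (m+[n∸m]≡n s≤dm+e) ⟩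
      (d * m + e) * (s + e)
    ≡⟨ expand d m e s ⟩
      d * m * s + (d * e * m + e * e) + e * s ∎
    where
    factor : ∀ s k e → s * s + k * (s + e) + e * s ≡ (s + k) * (s + e)
    factor = solve-∀
    expand : ∀ d m e s → (d * m + e) * (s + e) ≡ d * m * s + (d * e * m + e * e) + e * s
    expand = solve-∀

AlphaBracket-[] : ∀ d {c} → c ≤ d → AlphaBracket d c 0 0
AlphaBracket-[] d {c} c≤d = subst (_< 1) (sym (vanish d)) (s≤s z≤n) , (begin-strict
    (c + 0) * (c + 0)
  ≤⟨ *-monoˡ-≤ (c + 0) (subst (_≤ d) (sym (+-identityʳ c)) c≤d) ⟩
    d * (c + 0)
  ≡⟨ cong (_* (c + 0)) (sym (*-identityʳ d)) ⟩
    d * 1 * (c + 0)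
  <⟨ m<m+n _ (s≤s z≤n) ⟩
    d * 1 * (c + 0) + 1 * 1 ∎)
  where
  open ≤-Reasoning
  vanish : ∀ d → d * 0 * 1 + 0 * 0 ≡ 0
  vanish = solve-∀

c+[x+dn+e]≤d[1+n]+e : ∀ d c x n e → c + x ≤ d → c + (x + d * n + e) ≤ d * suc n + e
c+[x+dn+e]≤d[1+n]+e d c x n e c+x≤d = begin
    c + (x + d * n + e)
  ≡⟨ sym (trans (cong (_+ e) (+-assoc c x (d * n))) (+-assoc c (x + d * n) e)) ⟩
    c + x + d * n + e
  ≤⟨ +-monoˡ-≤ e (+-monoˡ-≤ (d * n) c+x≤d) ⟩
    d + d * n + e
  ≡⟨ cong (_+ e) (sym (*-suc d n)) ⟩
    d * suc n + e ∎
  where open ≤-Reasoning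

AlphaBracket-∷ : ∀ {d c} x xs → c + x ≤ d →
  AlphaBracket d 0 (valFrom d 0 xs) (val d xs) →
  AlphaBracket d c (valFrom d 0 (x ∷ xs)) (val d (x ∷ xs))
AlphaBracket-∷ {d} {c} x xs c+x≤d (αe<n+1 , n<α[e+1]) =
  subst₂ (AlphaBracket d c) (sym (valFrom-zero-∷ d x xs)) (sym (val-∷ d x xs))
    ( α*n<suc[x+dn+e] d n e x n<α[e+1]
    , ≤dm+e⇒<α*m d (suc n) e (c+[x+dn+e]≤d[1+n]+e d c x n e c+x≤d) αe<n+1 )
  where
  n e : ℕ
  n = val d xs
  e = valFrom d 0 xs

OstTail⇒AlphaBracket : ∀ {d p w} → OstTail d p w → AlphaBracket d 0 (valFrom d 0 w) (val d w)
OstTail⇒AlphaBracket {d} [] = AlphaBracket-[] d z≤n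
OstTail⇒AlphaBracket {w = x ∷ xs} ((x≤d , _) ∷ t) =
  AlphaBracket-∷ x xs x≤d (OstTail⇒AlphaBracket t)

Ostrowski⇒AlphaBracket : ∀ {d} w → 1 ≤ d → Ostrowski d w →
  AlphaBracket d 1 (valFrom d 0 w) (val d w)
Ostrowski⇒AlphaBracket {d} []       1≤d _         = AlphaBracket-[] d 1≤d
Ostrowski⇒AlphaBracket (x ∷ xs) _   (x<d , t) = AlphaBracket-∷ x xs x<d (OstTail⇒AlphaBracket t)

[dm+2e]²+4m²≡[d²+4]m²+4[dem+e²] : ∀ d m e →
  (d * m + 2 * e) * (d * m + 2 * e) + 4 * (m * m)
    ≡ (d * d + 4) * (m * m) + 4 * (d * e * m + e * e)
[dm+2e]²+4m²≡[d²+4]m²+4[dem+e²] = solve-∀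

α*e<m⇒[dm+2e]²<[d²+4]m² : ∀ d m e → α[ d ]* e < m →
  (d * m + 2 * e) * (d * m + 2 * e) < (d * d + 4) * (m * m)
α*e<m⇒[dm+2e]²<[d²+4]m² d m e αe<m = +-cancelʳ-< (4 * (m * m)) _ _ (begin-strict
    (d * m + 2 * e) * (d * m + 2 * e) + 4 * (m * m)
  ≡⟨ [dm+2e]²+4m²≡[d²+4]m²+4[dem+e²] d m e ⟩
    (d * d + 4) * (m * m) + 4 * (d * e * m + e * e)
  <⟨ +-monoʳ-< ((d * d + 4) * (m * m)) (*-monoʳ-< 4 αe<m) ⟩
    (d * d + 4) * (m * m) + 4 * (m * m) ∎)
  where open ≤-Reasoning

m<α*e⇒[d²+4]m²<[dm+2e]² : ∀ d m e → m <α[ d ]* e →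
  (d * d + 4) * (m * m) < (d * m + 2 * e) * (d * m + 2 * e)
m<α*e⇒[d²+4]m²<[dm+2e]² d m e m<αe = +-cancelʳ-< (4 * (m * m)) _ _ (begin-strict
    (d * d + 4) * (m * m) + 4 * (m * m)
  <⟨ +-monoʳ-< ((d * d + 4) * (m * m)) (*-monoʳ-< 4 m<αe) ⟩
    (d * d + 4) * (m * m) + 4 * (d * e * m + e * e)
  ≡⟨ sym ([dm+2e]²+4m²≡[d²+4]m²+4[dem+e²] d m e) ⟩
    (d * m + 2 * e) * (d * m + 2 * e) + 4 * (m * m) ∎)
  where open ≤-Reasoning

floor-numerator : ∀ d n e →
  + 2 ℤ.* + (d * n + e) ℤ.- + d ℤ.* (+ n ℤ.- + 1) ≡ + (d * suc n + 2 * e)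
floor-numerator d n e = begin
    + 2 ℤ.* (+ (d * n) ℤ.+ + e) ℤ.- + d ℤ.* (+ n ℤ.- + 1)
  ≡⟨ cong (λ i → + 2 ℤ.* (i ℤ.+ + e) ℤ.- + d ℤ.* (+ n ℤ.- + 1)) (ℤ.pos-* d n) ⟩
    + 2 ℤ.* (+ d ℤ.* + n ℤ.+ + e) ℤ.- + d ℤ.* (+ n ℤ.- + 1)
  ≡⟨ simplify (+ d) (+ n) (+ e) ⟩
    + d ℤ.* (+ 1 ℤ.+ + n) ℤ.+ + 2 ℤ.* + e
  ≡⟨ sym (cong₂ ℤ._+_ (ℤ.pos-* d (suc n)) (ℤ.pos-* 2 e)) ⟩
    + (d * suc n + 2 * e) ∎
  where
  open ≡-Reasoning
  simplify : ∀ D N E →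
    + 2 ℤ.* (D ℤ.* N ℤ.+ E) ℤ.- D ℤ.* (N ℤ.- + 1) ≡ D ℤ.* (+ 1 ℤ.+ N) ℤ.+ + 2 ℤ.* E
  simplify = ℤ-Solver.solve-∀

AlphaBracket⇒IsFloorAlpha : ∀ d n e → AlphaBracket d 1 e n → IsFloorAlpha d n (+ (d * n + e))
AlphaBracket⇒IsFloorAlpha d n e (αe<n+1 , n+1<α[e+1]) =
  subst (λ lo → IntLeSqrt Δ (suc n) lo × SqrtLtInt Δ (suc n) (lo ℤ.+ + 2))
        (sym (floor-numerator d n e))
        ( inj₂ (square-≤ L (<⇒≤ (α*e<m⇒[dm+2e]²<[d²+4]m² d (suc n) e αe<n+1)))
        , ℤ.+<+ (<-≤-trans (s≤s z≤n) (m≤n+m 2 L))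
        , square-> (L + 2) (subst (λ u → Δ * (suc n * suc n) < u * u) (sym L+2≡)
                     (m<α*e⇒[d²+4]m²<[dm+2e]² d (suc n) (suc e) n+1<α[e+1])) )
  where
  Δ L : ℕ
  Δ = d * d + 4
  L = d * suc n + 2 * e
  L+2≡ : L + 2 ≡ d * suc n + 2 * suc e
  L+2≡ = shift d n e
    where
    shift : ∀ d n e → d * suc n + 2 * e + 2 ≡ d * suc n + 2 * suc e
    shift = solve-∀
  square-≤ : ∀ b {a} → b * b ≤ a → + b ℤ.* + b ℤ.≤ + a
  square-≤ b b²≤a = subst (ℤ._≤ _) (ℤ.pos-* b b) (ℤ.+≤+ b²≤a)
  square-> : ∀ b {a} → a < b * b → + a ℤ.< + b ℤ.* + b
  square-> b a<b² = subst (_ ℤ.<_) (ℤ.pos-* b b) (ℤ.+<+ a<b²)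

lemma1 : (d : ℕ) → 2 ≤ d → (n : ℕ) → (w : List ℕ) →
    Ostrowski d w → LastNonzero w → val d w ≡ n →
    IsFloorAlpha d n (+ val d (0 ∷ w))
lemma1 d 2≤d .(val d w) w ost _ refl =
  subst (IsFloorAlpha d (val d w)) (cong +_ (sym (valFrom-suc-suc d 0 w)))
    (AlphaBracket⇒IsFloorAlpha d (val d w) (valFrom d 0 w)
      (Ostrowski⇒AlphaBracket w (≤-trans (s≤s z≤n) 2≤d) ost))
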